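{- The notion of reduction $\mathit{ass}$ is strongly normalizing: there is no infinite sequence of computations $M_0\longrightarrow_{\mathit{ass}}M_1\longrightarrow_{\mathit{ass}}M_2\longrightarrow_{\mathit{ass}}\cdots$.
   Context: Syntax of $\lambda_c^u$: values $V ::= x\mid \lambda x.M$, computations $M ::= \mathit{unit}\,V\mid M\star V$. $\mathit{ass}$ is the set of pairs $((L\star\lambda x.M)\star\lambda y.N,\ L\star\lambda x.(M\star\lambda y.N))$ with $x\notin FV(N)$. $\longrightarrow_{\mathit{ass}}$ is its compatible closure: if $(M,M')\in\mathit{ass}$ then $\mathcal C[M]\longrightarrow_{\mathit{ass}}\mathcal C[M']$ for every computation context, where value contexts are $\mathcal V ::= [\cdot]\mid\lambda x.\mathcal C$ and computation contexts $\mathcal C ::= [\cdot]\mid\mathit{unit}\,\mathcal V\mid\mathcal C\star V\mid M\star\mathcal V$. -}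

module Defs where

open import Data.Nat using (ℕ; suc)
open import Data.Product using (Σ)
open import Relation.Nullary using (¬_)
open import Relation.Binary.PropositionalEquality using (_≡_)

Var : Set
Var = ℕ

mutual
  data Val : Set where
    var : Var → Val
    lam : Var → Comp → Val

  data Comp : Set where
    unit : Val → Comp
    _⋆_  : Comp → Val → Comp

infixl 5 _⋆_

mutual
  data _∈FVᵥ_ (x : Var) : Val → Set where
    fv-var : x ∈FVᵥ var x
    fv-lam : ∀ {y M} → ¬ (x ≡ y) → x ∈FV M → x ∈FVᵥ lam y M

  data _∈FV_ (x : Var) : Comp → Set where
    fv-unit : ∀ {V} → x ∈FVᵥ V → x ∈FV unit V
    fv-⋆ˡ   : ∀ {M V} → x ∈FV M → x ∈FV (M ⋆ V)
    fv-⋆ʳ   : ∀ {M V} → x ∈FVᵥ V → x ∈FV (M ⋆ V)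

data Ass : Comp → Comp → Set where
  ass : ∀ L x M y N → ¬ (x ∈FV N) →
        Ass ((L ⋆ lam x M) ⋆ lam y N) (L ⋆ lam x (M ⋆ lam y N))

-- Compatible closure over value contexts  𝒱 ::= [·] | λx.𝒞
-- and computation contexts  𝒞 ::= [·] | unit 𝒱 | 𝒞 ⋆ V | M ⋆ 𝒱.
-- Since the hole is always of computation sort, the closure is:
mutual
  data _⟶ᵥ_ : Val → Val → Set where
    ξ-lam : ∀ {x M M'} → M ⟶ M' → lam x M ⟶ᵥ lam x M'

  data _⟶_ : Comp → Comp → Set where
    root  : ∀ {M M'} → Ass M M' → M ⟶ M'
    ξ-unit : ∀ {V V'} → V ⟶ᵥ V' → unit V ⟶ unit V'
    ξ-⋆ˡ  : ∀ {M M' V} → M ⟶ M' → (M ⋆ V) ⟶ (M' ⋆ V)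
    ξ-⋆ʳ  : ∀ {M V V'} → V ⟶ᵥ V' → (M ⋆ V) ⟶ (M ⋆ V')

infix 4 _⟶_ _⟶ᵥ_

InfiniteReduction : Set
InfiniteReduction = Σ (ℕ → Comp) (λ f → ∀ n → f n ⟶ f (suc n))

-- Interpret computations in ℕ, counting the left operand of ⋆ twice:
-- w (M ⋆ V) = 2 · w M + w V.  The associator moves the bind ⋆ λy.N out of
-- the doubled position, so w((L ⋆ λx.M) ⋆ λy.N) exceeds
-- w(L ⋆ λx.(M ⋆ λy.N)) by 2 · w L + 1; the interpretation is monotone, so
-- every ⟶_ass step lowers the weight, and ℕ admits no infinite descent.
module Submission where

open import Defs
open import Data.Nat using (ℕ; suc; _+_; _*_; _≤_; _<_; s≤s)
open import Data.Nat.Properties using (m≤m+n; +-monoˡ-<; +-monoʳ-<; *-monoʳ-<)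
open import Data.Nat.Induction using (<-wellFounded)
open import Data.Nat.Tactic.RingSolver using (solve-∀)
open import Data.Product using (_,_)
open import Function using (flip)
open import Induction.WellFounded using (WellFounded; Acc; acc; module Subrelation)
open import Induction.InfiniteDescent using (InfiniteDescendingSequence)
open import Relation.Binary.Core using (Rel)
open import Relation.Binary.Construct.On as On using ()
open import Relation.Binary.PropositionalEquality using (_≡_; sym; subst)
open import Relation.Nullary using (¬_)

acc⇒¬infiniteDescent : ∀ {a r} {A : Set a} {_<_ : Rel A r} (f : ℕ → A) (n : ℕ) →
                       Acc _<_ (f n) → ¬ InfiniteDescendingSequence _<_ f
acc⇒¬infiniteDescent f n (acc rs) desc = acc⇒¬infiniteDescent f (suc n) (rs (desc n)) desc

wf⇒¬infiniteDescent : ∀ {a r} {A : Set a} {_<_ : Rel A r} → WellFounded _<_ →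
                      (f : ℕ → A) → ¬ InfiniteDescendingSequence _<_ f
wf⇒¬infiniteDescent wf f = acc⇒¬infiniteDescent f 0 (wf (f 0))

mutual
  weightᵥ : Val → ℕ
  weightᵥ (var _)   = 1
  weightᵥ (lam _ M) = suc (weight M)

  weight : Comp → ℕ
  weight (unit V) = suc (weightᵥ V)
  weight (M ⋆ V)  = 2 * weight M + weightᵥ V

-- The drop 2 · l + 1 is moved to the right so that the identity is free of subtraction.
associator-weight : ∀ l m n →
  2 * (2 * l + suc m) + suc n ≡ suc (2 * l + suc (2 * m + suc n)) + 2 * l
associator-weight = solve-∀

ass-weight-< : ∀ {M M'} → Ass M M' → weight M' < weight M
ass-weight-< (ass L x M y N _) =
  subst (suc (weight (L ⋆ lam x (M ⋆ lam y N))) ≤_)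
        (sym (associator-weight (weight L) (weight M) (weight N)))
        (m≤m+n _ _)

mutual
  ⟶ᵥ-weight-< : ∀ {V V'} → V ⟶ᵥ V' → weightᵥ V' < weightᵥ V
  ⟶ᵥ-weight-< (ξ-lam r) = s≤s (⟶-weight-< r)

  ⟶-weight-< : ∀ {M M'} → M ⟶ M' → weight M' < weight M
  ⟶-weight-< (root r)         = ass-weight-< r
  ⟶-weight-< (ξ-unit r)       = s≤s (⟶ᵥ-weight-< r)
  ⟶-weight-< (ξ-⋆ˡ {V = V} r) = +-monoˡ-< (weightᵥ V) (*-monoʳ-< 2 (⟶-weight-< r))
  ⟶-weight-< (ξ-⋆ʳ {M = M} r) = +-monoʳ-< (2 * weight M) (⟶ᵥ-weight-< r)

⟶-wellFounded : WellFounded (flip _⟶_)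
⟶-wellFounded = Subrelation.wellFounded ⟶-weight-< (On.wellFounded weight <-wellFounded)

mainTheorem16 : ¬ InfiniteReduction
mainTheorem16 (f , step) = wf⇒¬infiniteDescent ⟶-wellFounded f step
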